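{- Let $L$ be a principal MS-algebra with smallest dense element $d_L$. For every congruence $\theta$ of $L$, the pair $(\theta_{L^{\circ\circ}},\theta_{D(L)})$ of restrictions of $\theta$ to $L^{\circ\circ}$ and to $D(L)=[d_L)$ is an MS-congruence pair. Conversely, every MS-congruence pair $(\theta_1,\theta_2)$ uniquely determines a congruence $\theta$ of $L$ with $\theta_{L^{\circ\circ}}=\theta_1$ and $\theta_{D(L)}=\theta_2$; this congruence is given by: $(x,y)\in\theta$ if and only if $(x^{\circ},y^{\circ})\in\theta_1$ and $(x\vee d_L,y\vee d_L)\in\theta_2$.
   Context: An MS-algebra is an algebra $(L;\vee,\wedge,{}^{\circ},0,1)$ where $(L;\vee,\wedge,0,1)$ is a bounded distributive lattice and ${}^{\circ}$ is a unary operation with $x\le x^{\circ\circ}$, $(x\wedge y)^{\circ}=x^{\circ}\vee y^{\circ}$ and $1^{\circ}=0$. For such $L$, $L^{\circ\circ}=\{x\in L\mid x=x^{\circ\circ}\}$ is a subalgebra which is a de Morgan algebra (an MS-algebra with $x=x^{\circ\circ}$), and $D(L)=\{x\in L\mid x^{\circ}=0\}$ is a filter. $L$ is a principal MS-algebra if there is $d_L\in L$ with $D(L)=[d_L)=\{x\mid x\ge d_L\}$ and $x=x^{\circ\circ}\wedge(x\vee d_L)$ for all $x\in L$. $\mathrm{Con}(L^{\circ\circ})$ denotes the congruence lattice of the de Morgan algebra $L^{\circ\circ}$ and $\mathrm{Con}(D(L))$ the congruence lattice of the lattice $D(L)$. An MS-congruence pair of $L$ is a pair $(\theta_1,\theta_2)\in\mathrm{Con}(L^{\circ\circ})\times\mathrm{Con}(D(L))$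 such that $(a,b)\in\theta_1$ implies $(a\vee d_L,b\vee d_L)\in\theta_2$. -}

module Defs where

open import Level using (Level; _⊔_; suc)
open import Data.Product using (_×_; Σ; _,_)
open import Relation.Binary.PropositionalEquality using (_≡_)
open import Relation.Binary.Core using (Rel)
open import Algebra.Core using (Op₁; Op₂)
open import Algebra.Definitions using (Identity)
open import Algebra.Lattice.Structures using (IsDistributiveLattice)

record MSAlgebra (a : Level) : Set (suc a) where
  infixr 6 _∨_
  infixr 7 _∧_
  infix 8 _°
  field
    Carrier : Set a
    _∨_ _∧_ : Op₂ Carrier
    _°      : Op₁ Carrier
    𝟘 𝟙     : Carrier
    isDistributiveLattice : IsDistributiveLattice _≡_ _∨_ _∧_
    ∨-identity : Identity _≡_ 𝟘 _∨_
    ∧-identity : Identity _≡_ 𝟙 _∧_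

  infix 4 _≤_
  _≤_ : Rel Carrier a
  x ≤ y = x ∧ y ≡ x

  field
    ≤-°° : ∀ x → x ≤ ((x °) °)
    ∧-° : ∀ x y → (x ∧ y) ° ≡ x ° ∨ y °
    𝟙-° : 𝟙 ° ≡ 𝟘

  InSkeleton : Carrier → Set a
  InSkeleton x = x ≡ x ° °

  Dense : Carrier → Set a
  Dense x = x ° ≡ 𝟘

record IsPrincipal {a} (L : MSAlgebra a) (d : MSAlgebra.Carrier L) : Set a where
  open MSAlgebra L
  field
    dense⇒≥d : ∀ x → Dense x → d ≤ x
    ≥d⇒dense : ∀ x → d ≤ x → Dense x
    decomp   : ∀ x → x ≡ (x ° °) ∧ (x ∨ d)

module _ {a} (L : MSAlgebra a) where
  open MSAlgebra L

  -- Congruence of the MS-algebra L (constants are trivially compatible).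
  record IsCongruence {ℓ} (θ : Rel Carrier ℓ) : Set (a ⊔ ℓ) where
    field
      refl  : ∀ x → θ x x
      sym   : ∀ {x y} → θ x y → θ y x
      trans : ∀ {x y z} → θ x y → θ y z → θ x z
      ∨-cong : ∀ {x y u v} → θ x y → θ u v → θ (x ∨ u) (y ∨ v)
      ∧-cong : ∀ {x y u v} → θ x y → θ u v → θ (x ∧ u) (y ∧ v)
      °-cong : ∀ {x y} → θ x y → θ (x °) (y °)

  -- A relation on a subset S of the carrier, represented as a relation on the
  -- carrier that only relates elements of S.
  -- Congruence of the de Morgan algebra L°° (relation on L°°):
  record IsSkeletonCongruence {ℓ} (θ : Rel Carrier ℓ) : Set (a ⊔ ℓ) where
    field
      support : ∀ {x y} → θ x y → InSkeleton x × InSkeleton y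
      refl  : ∀ x → InSkeleton x → θ x x
      sym   : ∀ {x y} → θ x y → θ y x
      trans : ∀ {x y z} → θ x y → θ y z → θ x z
      ∨-cong : ∀ {x y u v} → θ x y → θ u v → θ (x ∨ u) (y ∨ v)
      ∧-cong : ∀ {x y u v} → θ x y → θ u v → θ (x ∧ u) (y ∧ v)
      °-cong : ∀ {x y} → θ x y → θ (x °) (y °)

  record IsDenseCongruence {ℓ} (θ : Rel Carrier ℓ) : Set (a ⊔ ℓ) where
    field
      support : ∀ {x y} → θ x y → Dense x × Dense y
      refl  : ∀ x → Dense x → θ x x
      sym   : ∀ {x y} → θ x y → θ y x
      trans : ∀ {x y z} → θ x y → θ y z → θ x z
      ∨-cong : ∀ {x y u v} → θ x y → θ u v → θ (x ∨ u) (y ∨ v)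
      ∧-cong : ∀ {x y u v} → θ x y → θ u v → θ (x ∧ u) (y ∧ v)

  record IsMSCongruencePair {ℓ₁ ℓ₂} (d : Carrier)
         (θ₁ : Rel Carrier ℓ₁) (θ₂ : Rel Carrier ℓ₂) : Set (a ⊔ ℓ₁ ⊔ ℓ₂) where
    field
      fst-con : IsSkeletonCongruence θ₁
      snd-con : IsDenseCongruence θ₂
      compat  : ∀ {x y} → θ₁ x y → θ₂ (x ∨ d) (y ∨ d)

  restrict-skel : ∀ {ℓ} → Rel Carrier ℓ → Rel Carrier (a ⊔ ℓ)
  restrict-skel θ x y = InSkeleton x × InSkeleton y × θ x y

  restrict-dense : ∀ {ℓ} → Rel Carrier ℓ → Rel Carrier (a ⊔ ℓ)
  restrict-dense θ x y = Dense x × Dense y × θ x y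

  pairRel : ∀ {ℓ₁ ℓ₂} (d : Carrier) → Rel Carrier ℓ₁ → Rel Carrier ℓ₂ → Rel Carrier (ℓ₁ ⊔ ℓ₂)
  pairRel d θ₁ θ₂ x y = θ₁ (x °) (y °) × θ₂ (x ∨ d) (y ∨ d)

_≐_ : ∀ {a ℓ₁ ℓ₂} {A : Set a} → Rel A ℓ₁ → Rel A ℓ₂ → Set (a ⊔ ℓ₁ ⊔ ℓ₂)
R ≐ S = ∀ x y → (R x y → S x y) × (S x y → R x y)

module Submission where

-- The proof
-- rests on two facts about L:
--   * the skeleton L°° = {x | x = x°°} and the filter D(L) = {x | x° = 0}
--     are closed under the operations, so a congruence of L restricts to a
--     congruence of L°° and to a lattice congruence of D(L);
--   * every x is recovered from x° ∈ L°° and x ∨ d ∈ D(L) through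
--     x = x°° ∧ (x ∨ d), so a congruence θ relates x and y exactly when it
--     relates x°, y° and x ∨ d, y ∨ d ("θ is separated by ° and ∨ d").
-- Conversely, for an MS-congruence pair (θ₁, θ₂) the relation
-- x θ y ⇔ x° θ₁ y° ∧ (x ∨ d) θ₂ (y ∨ d) is a congruence since ° turns ∨
-- into ∧ and back, x ↦ x ∨ d is a lattice homomorphism, and the pair
-- condition handles °.  Its restrictions are θ₁ and θ₂, and by separation
-- any congruence with these restrictions coincides with it.

open import Defs
open import Data.Product using (_×_; _,_; proj₁; proj₂)
open import Relation.Binary.Core using (Rel)
open import Relation.Binary.PropositionalEquality
  using (_≡_; sym; trans; cong; cong₂; subst; subst₂; module ≡-Reasoning)
open import Algebra.Lattice.Bundles using (DistributiveLattice)
open import Algebra.Structures using (IsCommutativeBand)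
open import Algebra.Bundles using (CommutativeSemigroup)
import Algebra.Lattice.Properties.Lattice as LatticeProperties
import Algebra.Properties.CommutativeSemigroup as CommutativeSemigroupProperties
import Relation.Binary.Lattice as OrderLattice
import Relation.Binary.Lattice.Properties.JoinSemilattice as JoinSemilatticeProperties
import Relation.Binary.Reasoning.PartialOrder as PosetReasoning

module MSAlgebraProperties {a} (L : MSAlgebra a) where
  open MSAlgebra L hiding (_≤_)

  distributiveLattice : DistributiveLattice a a
  distributiveLattice = record { isDistributiveLattice = isDistributiveLattice }

  open DistributiveLattice distributiveLattice public
    using (∨-comm; ∧-comm; ∧-absorbs-∨; ∨-distribʳ-∧)
  open LatticeProperties (DistributiveLattice.lattice distributiveLattice) public
    using (∧-idem; ∨-idem; ∨-isSemilattice; ∨-∧-orderTheoreticLattice)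

  -- The lattice order of L as an order-theoretic lattice.  In the library
  -- x ≤ y means x ≡ x ∧ y, the symmetric form of the order used in Defs.
  open OrderLattice.Lattice ∨-∧-orderTheoreticLattice public
    using (_≤_; poset; antisym; x≤x∨y; y≤x∨y; ∧-greatest; joinSemilattice)
  open JoinSemilatticeProperties joinSemilattice public using (∨-monotonic; x≤y⇒x∨y≈y)

  x≤x°° : ∀ x → x ≤ x ° °
  x≤x°° x = sym (≤-°° x)

  ∧-zeroʳ : ∀ x → x ∧ 𝟘 ≡ 𝟘
  ∧-zeroʳ x = trans (∧-comm x 𝟘)
    (trans (cong (𝟘 ∧_) (sym (proj₁ ∨-identity x))) (∧-absorbs-∨ 𝟘 x))

  °-antitone : ∀ {x y} → x ≤ y → y ° ≤ x °
  °-antitone {x} {y} x≤y = begin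
    y °                 ≡⟨ sym (∧-absorbs-∨ (y °) (x °)) ⟩
    y ° ∧ (y ° ∨ x °)   ≡⟨ cong (y ° ∧_) (∨-comm (y °) (x °)) ⟩
    y ° ∧ (x ° ∨ y °)   ≡⟨ cong (y ° ∧_) (sym (∧-° x y)) ⟩
    y ° ∧ (x ∧ y) °     ≡⟨ cong (λ t → y ° ∧ t °) (sym x≤y) ⟩
    y ° ∧ x °           ∎
    where open ≡-Reasoning

  °°°-law : ∀ x → x ° ° ° ≡ x °
  °°°-law x = antisym (°-antitone (x≤x°° x)) (x≤x°° (x °))

  ∨-° : ∀ x y → (x ∨ y) ° ≡ x ° ∧ y °
  ∨-° x y = antisym (∧-greatest (°-antitone (x≤x∨y x y)) (°-antitone (y≤x∨y x y))) (begin
    x ° ∧ y °           ≤⟨ x≤x°° (x ° ∧ y °) ⟩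
    (x ° ∧ y °) ° °     ≡⟨ cong _° (∧-° (x °) (y °)) ⟩
    (x ° ° ∨ y ° °) °   ≤⟨ °-antitone (∨-monotonic (x≤x°° x) (x≤x°° y)) ⟩
    (x ∨ y) °           ∎)
    where open PosetReasoning poset

  °-skel : ∀ x → InSkeleton (x °)
  °-skel x = sym (°°°-law x)

  𝟘-skel : InSkeleton 𝟘
  𝟘-skel = subst InSkeleton 𝟙-° (°-skel 𝟙)

  ∨-skel : ∀ {x y} → InSkeleton x → InSkeleton y → InSkeleton (x ∨ y)
  ∨-skel {x} {y} x°°≡x y°°≡y = begin
    x ∨ y               ≡⟨ cong₂ _∨_ x°°≡x y°°≡y ⟩
    x ° ° ∨ y ° °       ≡⟨ sym (∧-° (x °) (y °)) ⟩
    (x ° ∧ y °) °       ≡⟨ cong _° (sym (∨-° x y)) ⟩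
    (x ∨ y) ° °         ∎
    where open ≡-Reasoning

  ∧-skel : ∀ {x y} → InSkeleton x → InSkeleton y → InSkeleton (x ∧ y)
  ∧-skel {x} {y} x°°≡x y°°≡y = begin
    x ∧ y               ≡⟨ cong₂ _∧_ x°°≡x y°°≡y ⟩
    x ° ° ∧ y ° °       ≡⟨ sym (∨-° (x °) (y °)) ⟩
    (x ° ∨ y °) °       ≡⟨ cong _° (sym (∧-° x y)) ⟩
    (x ∧ y) ° °         ∎
    where open ≡-Reasoning

  -- D(L) is a filter: it is up-closed (in the form x ∨ y ≥ y) and closed under ∧.
  ∨-dense : ∀ x {y} → Dense y → Dense (x ∨ y)
  ∨-dense x {y} y°≡𝟘 = trans (∨-° x y) (trans (cong (x ° ∧_) y°≡𝟘) (∧-zeroʳ (x °)))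

  ∧-dense : ∀ {x y} → Dense x → Dense y → Dense (x ∧ y)
  ∧-dense {x} {y} x°≡𝟘 y°≡𝟘 = trans (∧-° x y) (trans (cong₂ _∨_ x°≡𝟘 y°≡𝟘) (∨-idem 𝟘))

  restrict-skel-isSkeletonCongruence : ∀ {ℓ} {θ : Rel Carrier ℓ} →
    IsCongruence L θ → IsSkeletonCongruence L (restrict-skel L θ)
  restrict-skel-isSkeletonCongruence θ-con = record
    { support = λ (sx , sy , _) → sx , sy
    ; refl    = λ x sx → sx , sx , θ.refl x
    ; sym     = λ (sx , sy , xθy) → sy , sx , θ.sym xθy
    ; trans   = λ (sx , _ , xθy) (_ , sz , yθz) → sx , sz , θ.trans xθy yθz
    ; ∨-cong  = λ (sx , sy , xθy) (su , sv , uθv) →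
                  ∨-skel sx su , ∨-skel sy sv , θ.∨-cong xθy uθv
    ; ∧-cong  = λ (sx , sy , xθy) (su , sv , uθv) →
                  ∧-skel sx su , ∧-skel sy sv , θ.∧-cong xθy uθv
    ; °-cong  = λ {x} {y} (_ , _ , xθy) → °-skel x , °-skel y , θ.°-cong xθy
    }
    where module θ = IsCongruence θ-con

  restrict-dense-isDenseCongruence : ∀ {ℓ} {θ : Rel Carrier ℓ} →
    IsCongruence L θ → IsDenseCongruence L (restrict-dense L θ)
  restrict-dense-isDenseCongruence θ-con = record
    { support = λ (dx , dy , _) → dx , dy
    ; refl    = λ x dx → dx , dx , θ.refl x
    ; sym     = λ (dx , dy , xθy) → dy , dx , θ.sym xθy
    ; trans   = λ (dx , _ , xθy) (_ , dz , yθz) → dx , dz , θ.trans xθy yθz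
    ; ∨-cong  = λ {x} {y} (_ , _ , xθy) (du , dv , uθv) →
                  ∨-dense x du , ∨-dense y dv , θ.∨-cong xθy uθv
    ; ∧-cong  = λ (dx , dy , xθy) (du , dv , uθv) →
                  ∧-dense dx du , ∧-dense dy dv , θ.∧-cong xθy uθv
    }
    where module θ = IsCongruence θ-con

module PrincipalMSAlgebra {a} (L : MSAlgebra a) (d : MSAlgebra.Carrier L)
                          (principal : IsPrincipal L d) where
  open MSAlgebra L hiding (_≤_)
  open MSAlgebraProperties L
  open IsPrincipal principal

  d-dense : Dense d
  d-dense = ≥d⇒dense d (∧-idem d)

  ∨d-dense : ∀ x → Dense (x ∨ d)
  ∨d-dense x = ∨-dense x d-dense

  ∨d-fixes-dense : ∀ {x} → Dense x → x ∨ d ≡ x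
  ∨d-fixes-dense {x} x°≡𝟘 = trans (∨-comm x d) (x≤y⇒x∨y≈y (sym (dense⇒≥d x x°≡𝟘)))

  ∨d-preserves-∨ : ∀ x y → (x ∨ y) ∨ d ≡ (x ∨ d) ∨ (y ∨ d)
  ∨d-preserves-∨ x y = begin
    (x ∨ y) ∨ d         ≡⟨ cong ((x ∨ y) ∨_) (sym (∨-idem d)) ⟩
    (x ∨ y) ∨ (d ∨ d)   ≡⟨ interchange x y d d ⟩
    (x ∨ d) ∨ (y ∨ d)   ∎
    where
    open ≡-Reasoning
    ∨-commutativeSemigroup : CommutativeSemigroup a a
    ∨-commutativeSemigroup = record
      { isCommutativeSemigroup = IsCommutativeBand.isCommutativeSemigroup ∨-isSemilattice }
    open CommutativeSemigroupProperties ∨-commutativeSemigroup using (interchange)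

  ∨d-preserves-∧ : ∀ x y → (x ∧ y) ∨ d ≡ (x ∨ d) ∧ (y ∨ d)
  ∨d-preserves-∧ x y = ∨-distribʳ-∧ d x y

  restrictions-form-pair : ∀ {ℓ} {θ : Rel Carrier ℓ} → IsCongruence L θ →
    IsMSCongruencePair L d (restrict-skel L θ) (restrict-dense L θ)
  restrictions-form-pair θ-con = record
    { fst-con = restrict-skel-isSkeletonCongruence θ-con
    ; snd-con = restrict-dense-isDenseCongruence θ-con
    ; compat  = λ {x} {y} (_ , _ , xθy) →
                  ∨d-dense x , ∨d-dense y , θ.∨-cong xθy (θ.refl d)
    }
    where module θ = IsCongruence θ-con

  -- A congruence of L is separated by ° and ∨ d: since x = x°° ∧ (x ∨ d),
  -- x θ y holds as soon as x° θ y° and (x ∨ d) θ (y ∨ d).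
  congruence-separated : ∀ {ℓ} {θ : Rel Carrier ℓ} → IsCongruence L θ → θ ≐ pairRel L d θ θ
  congruence-separated {θ = θ} θ-con x y =
      (λ xθy → θ.°-cong xθy , θ.∨-cong xθy (θ.refl d))
    , (λ (x°θy° , x∨dθy∨d) →
        subst₂ θ (sym (decomp x)) (sym (decomp y)) (θ.∧-cong (θ.°-cong x°θy°) x∨dθy∨d))
    where module θ = IsCongruence θ-con

  module _ {ℓ₁ ℓ₂} {θ₁ : Rel Carrier ℓ₁} {θ₂ : Rel Carrier ℓ₂}
           (pair : IsMSCongruencePair L d θ₁ θ₂) where
    private
      module P = IsMSCongruencePair pair
      module θ₁ = IsSkeletonCongruence P.fst-con
      module θ₂ = IsDenseCongruence P.snd-con

    pairRel-isCongruence : IsCongruence L (pairRel L d θ₁ θ₂)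
    pairRel-isCongruence = record
      { refl   = λ x → θ₁.refl (x °) (°-skel x) , θ₂.refl (x ∨ d) (∨d-dense x)
      ; sym    = λ (p , q) → θ₁.sym p , θ₂.sym q
      ; trans  = λ (p , q) (p′ , q′) → θ₁.trans p p′ , θ₂.trans q q′
      ; ∨-cong = λ {x} {y} {u} {v} (p , q) (p′ , q′) →
            subst₂ θ₁ (sym (∨-° x u)) (sym (∨-° y v)) (θ₁.∧-cong p p′)
          , subst₂ θ₂ (sym (∨d-preserves-∨ x u)) (sym (∨d-preserves-∨ y v)) (θ₂.∨-cong q q′)
      ; ∧-cong = λ {x} {y} {u} {v} (p , q) (p′ , q′) →
            subst₂ θ₁ (sym (∧-° x u)) (sym (∧-° y v)) (θ₁.∨-cong p p′)
          , subst₂ θ₂ (sym (∨d-preserves-∧ x u)) (sym (∨d-preserves-∧ y v)) (θ₂.∧-cong q q′)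
      ; °-cong = λ (p , _) → θ₁.°-cong p , P.compat p
      }

    -- Part 2b: its restriction to L°° is θ₁ (on L°° we have x = x°°) …
    pairRel-restrict-skel : restrict-skel L (pairRel L d θ₁ θ₂) ≐ θ₁
    pairRel-restrict-skel x y =
        (λ (sx , sy , x°θ₁y° , _) → subst₂ θ₁ (sym sx) (sym sy) (θ₁.°-cong x°θ₁y°))
      , (λ xθ₁y → let (sx , sy) = θ₁.support xθ₁y in
                   sx , sy , θ₁.°-cong xθ₁y , P.compat xθ₁y)

    -- … and its restriction to D(L) is θ₂ (on D(L) we have x° = 0 and x ∨ d = x).
    pairRel-restrict-dense : restrict-dense L (pairRel L d θ₁ θ₂) ≐ θ₂
    pairRel-restrict-dense x y =
        (λ (dx , dy , _ , x∨dθ₂y∨d) → subst₂ θ₂ (∨d-fixes-dense dx) (∨d-fixes-dense dy) x∨dθ₂y∨d)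
      , (λ xθ₂y → let (dx , dy) = θ₂.support xθ₂y in
           dx , dy , subst₂ θ₁ (sym dx) (sym dy) (θ₁.refl 𝟘 𝟘-skel)
           , subst₂ θ₂ (sym (∨d-fixes-dense dx)) (sym (∨d-fixes-dense dy)) xθ₂y)

  -- Part 2c: a congruence is determined by its restrictions to L°° and D(L),
  -- because by separation it only compares elements x° ∈ L°° and x ∨ d ∈ D(L).
  congruence-determined-by-restrictions :
    ∀ {ℓ ℓ₁ ℓ₂} {θ : Rel Carrier ℓ} {θ₁ : Rel Carrier ℓ₁} {θ₂ : Rel Carrier ℓ₂} →
    IsCongruence L θ → restrict-skel L θ ≐ θ₁ → restrict-dense L θ ≐ θ₂ →
    θ ≐ pairRel L d θ₁ θ₂
  congruence-determined-by-restrictions θ-con skel≐θ₁ dense≐θ₂ x y =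
      (λ xθy → let (x°θy° , x∨dθy∨d) = proj₁ (separated x y) xθy in
          proj₁ (skel≐θ₁ (x °) (y °)) (°-skel x , °-skel y , x°θy°)
        , proj₁ (dense≐θ₂ (x ∨ d) (y ∨ d)) (∨d-dense x , ∨d-dense y , x∨dθy∨d))
    , (λ (x°θ₁y° , x∨dθ₂y∨d) → proj₂ (separated x y)
          ( proj₂ (proj₂ (proj₂ (skel≐θ₁ (x °) (y °)) x°θ₁y°))
          , proj₂ (proj₂ (proj₂ (dense≐θ₂ (x ∨ d) (y ∨ d)) x∨dθ₂y∨d))))
    where separated = congruence-separated θ-con

theorem3p2 : ∀ {a ℓ} (L : MSAlgebra a) (d : MSAlgebra.Carrier L) → IsPrincipal L d →
    ((θ : Rel (MSAlgebra.Carrier L) ℓ) → IsCongruence L θ →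
      IsMSCongruencePair L d (restrict-skel L θ) (restrict-dense L θ))
    ×
    ((θ₁ θ₂ : Rel (MSAlgebra.Carrier L) ℓ) → IsMSCongruencePair L d θ₁ θ₂ →
      IsCongruence L (pairRel L d θ₁ θ₂)
      × (restrict-skel L (pairRel L d θ₁ θ₂) ≐ θ₁)
      × (restrict-dense L (pairRel L d θ₁ θ₂) ≐ θ₂)
      × ((θ : Rel (MSAlgebra.Carrier L) ℓ) → IsCongruence L θ →
          restrict-skel L θ ≐ θ₁ → restrict-dense L θ ≐ θ₂ → θ ≐ pairRel L d θ₁ θ₂))
theorem3p2 L d principal =
    (λ _ → restrictions-form-pair)
  , (λ θ₁ θ₂ pair →
        pairRel-isCongruence pair
      , pairRel-restrict-skel pair
      , pairRel-restrict-dense pair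
      , (λ _ → congruence-determined-by-restrictions))
  where open PrincipalMSAlgebra L d principal
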